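{- If $\mathcal U$ is a Shelah ultrafilter on $\omega$, then $\mathcal U$ is not a P-point.
   Context: An ideal on a countable set is a family of subsets closed under subsets and finite unions; $\mathcal U^*$ is the dual ideal of a filter $\mathcal U$. Ideals $\mathcal I$ on $X$ and $\mathcal J$ on $Y$ are isomorphic if there is a bijection $f:X\to Y$ with $f[A]\in\mathcal J\iff A\in\mathcal I$. $\mathcal I\le_K\mathcal J$ if there is $f:Y\to X$ with $f^{ -1}[I]\in\mathcal J$ for all $I\in\mathcal I$; Katětov equivalent means both directions. For an ideal $\mathcal I$ on $X$ and ideals $\mathcal J_i$ on $Y_i$, $\lim_{i\to\mathcal I}\mathcal J_i$ is the ideal on $\bigcup_i\{i\}\times Y_i$ of all $A$ with $\{i:A(i)\notin\mathcal J_i\}\in\mathcal I$ ($A(i)=\{y:(i,y)\in A\}$); $\mathcal I\times\mathcal J$ is the case $\mathcal J_i=\mathcal J$. $bnd(\alpha)$ is the ideal of bounded subsets of a countable limit $\alpha$. $fin^\alpha$ on $X_\alpha$: $X_0=\{0\}$, $fin^0=\{\emptyset\}$; $X_1=\omega$, $fin^1=fin$; $X_{\alpha+1}=\omega\times X_\alpha$, $fin^{\alpha+1}=fin\times fin^\alpha$; limit $\alpha$: $X_\alpha=\bigcup_{\beta<\alpha}\{\beta\}\times X_\beta$, $fin^\alpha=\lim_{\beta\to bnd(\alpha)}fin^\beta$. An ultrafilter $\mathcal U$ on $\omega$ is a Shelah ultrafilter if (1) for every $\alpha<\omega_1$ there is an ideal $\mathcal I$ isomorphic to $fin^\alpha$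 with $\mathcal I\subseteq\mathcal U^*$; (2) for every analytic ideal $\mathcal I$ with $\mathcal I\cap\mathcal U=\emptyset$ there are $\alpha<\omega_1$ and an ideal $\mathcal J$ Katětov equivalent to $fin^\alpha$ with $\mathcal I\subseteq\mathcal J\subseteq\mathcal U^*$. A nonprincipal ultrafilter $\mathcal U$ on $\omega$ is a P-point if for every $\{U_n:n\in\omega\}\subseteq\mathcal U$ there is $U\in\mathcal U$ with $U\setminus U_n$ finite for all $n$. -}

module Defs where

open import Level using (Level; 0ℓ) renaming (suc to lsuc)
open import Data.Nat using (ℕ; _<_)
open import Data.Bool using (Bool; true; false; _∧_)
open import Data.List using (List; map)
open import Data.List.Base using (upTo)
open import Data.Unit using (⊤)
open import Data.Empty using (⊥)
open import Data.Product using (Σ; ∃; _×_; _,_; proj₁)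
open import Data.Sum using (_⊎_)
open import Relation.Nullary using (¬_)
open import Relation.Binary.PropositionalEquality using (_≡_; _≢_)
open import Induction.WellFounded using (WellFounded)
open import Function.Bundles using (Bijection; _⤖_; _⇔_)

Subset : Set → Set₁
Subset X = X → Set

_⊆_ : {X : Set} → Subset X → Subset X → Set
A ⊆ B = ∀ x → A x → B x

∅ : {X : Set} → Subset X
∅ _ = ⊥

_∪_ : {X : Set} → Subset X → Subset X → Subset X
(A ∪ B) x = A x ⊎ B x

_∩_ : {X : Set} → Subset X → Subset X → Subset X
(A ∩ B) x = A x × B x

∁ : {X : Set} → Subset X → Subset X
∁ A x = ¬ A x

Family : Set → Set₁
Family X = Subset X → Set

_⊆F_ : {X : Set} → Family X → Family X → Set₁
I ⊆F J = ∀ A → I A → J A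

record IsIdeal {X : Set} (I : Family X) : Set₁ where
  field
    has-∅  : I ∅
    down   : ∀ A B → A ⊆ B → I B → I A
    union  : ∀ A B → I A → I B → I (A ∪ B)

record IsUltrafilter (U : Family ℕ) : Set₁ where
  field
    has-ω  : U (λ _ → ⊤)
    no-∅   : ¬ U ∅
    up     : ∀ A B → A ⊆ B → U A → U B
    inter  : ∀ A B → U A → U B → U (A ∩ B)
    ultra  : ∀ A → U A ⊎ U (∁ A)

dual : Family ℕ → Family ℕ
dual U A = U (∁ A)

Finite : Subset ℕ → Set
Finite A = ∃ λ N → ∀ k → A k → k < N

Nonprincipal : Family ℕ → Set
Nonprincipal U = ∀ n → ¬ U (λ k → k ≡ n)

IsPPoint : Family ℕ → Set₁
IsPPoint U =
  IsUltrafilter U × Nonprincipal U ×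
  ((Us : ℕ → Subset ℕ) → (∀ n → U (Us n)) →
     Σ (Subset ℕ) λ V → U V × (∀ n → Finite (λ k → V k × ¬ Us n k)))

image : {X Y : Set} → (X → Y) → Subset X → Subset Y
image f A y = ∃ λ x → A x × f x ≡ y

Isomorphic : {X Y : Set} → Family X → Family Y → Set₁
Isomorphic {X} {Y} I J =
  Σ (X ⤖ Y) λ f → ∀ A → J (image (Bijection.to f) A) ⇔ I A

_≤K_ : {X Y : Set} → Family X → Family Y → Set₁
_≤K_ {X} {Y} I J = Σ (Y → X) λ f → ∀ A → I A → J (λ y → A (f y))

KatetovEquiv : {X Y : Set} → Family X → Family Y → Set₁
KatetovEquiv I J = (I ≤K J) × (J ≤K I)

limIdeal : {X : Set} {Y : X → Set} → Family X → ((i : X) → Family (Y i)) →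
           Family (Σ X Y)
limIdeal I J A = I (λ i → ¬ J i (λ y → A (i , y)))

fin : Family ℕ
fin = Finite

_×I_ : {X Y : Set} → Family X → Family Y → Family (X × Y)
_×I_ {Y = Y} I J = limIdeal {Y = λ _ → Y} I (λ _ → J)

-- Countable ordinals, represented as well-orders on subsets of ℕ

record WOData : Set where
  field
    dom : ℕ → Bool
    lt  : ℕ → ℕ → Bool           -- the strict order (meaningful on dom)
open WOData public

El : WOData → Set
El D = Σ ℕ λ n → dom D n ≡ true

_≺[_]_ : ℕ → WOData → ℕ → Set
a ≺[ D ] b = lt D a b ≡ true

record IsWO (D : WOData) : Set where
  field
    irrefl : ∀ a → dom D a ≡ true → ¬ (a ≺[ D ] a)
    trans  : ∀ a b c → dom D a ≡ true → dom D b ≡ true → dom D c ≡ true →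
             a ≺[ D ] b → b ≺[ D ] c → a ≺[ D ] c
    total  : ∀ a b → dom D a ≡ true → dom D b ≡ true →
             (a ≡ b) ⊎ (a ≺[ D ] b) ⊎ (b ≺[ D ] a)
    wf     : WellFounded (λ a b → dom D a ≡ true × dom D b ≡ true × a ≺[ D ] b)

below : WOData → ℕ → WOData
below D m = record { dom = λ n → dom D n ∧ lt D n m ; lt = lt D }

Nonempty : WOData → Set
Nonempty D = ∃ λ n → dom D n ≡ true

IsMax : WOData → ℕ → Set
IsMax D m = dom D m ≡ true × (∀ n → dom D n ≡ true → n ≢ m → n ≺[ D ] m)

bnd : (D : WOData) → Family (El D)
bnd D B = ∃ λ (x : El D) → ∀ y → B y → proj₁ y ≺[ D ] proj₁ x

-- FinRel D X I : "X = X_α and I = fin^α", where α is the order type of D.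
-- Cases: α = 0, α = 1, α = β+1 with β ≥ 1, α limit.
data FinRel : WOData → (X : Set) → Family X → Set₁ where
  fr0 : ∀ {D} → (∀ n → dom D n ≡ false) →
        FinRel D ⊤ (λ A → ∀ x → ¬ A x)
  fr1 : ∀ {D} m → dom D m ≡ true → (∀ n → dom D n ≡ true → n ≡ m) →
        FinRel D ℕ fin
  frS : ∀ {D X I} m → IsMax D m → Nonempty (below D m) →
        FinRel (below D m) X I → FinRel D (ℕ × X) (fin ×I I)
  frL : ∀ {D} → Nonempty D →
        (∀ m → dom D m ≡ true → ∃ λ n → dom D n ≡ true × m ≺[ D ] n) →
        (Xs : El D → Set) (Is : (x : El D) → Family (Xs x)) →
        (∀ x → FinRel (below D (proj₁ x)) (Xs x) (Is x)) →
        FinRel D (Σ (El D) Xs) (limIdeal (bnd D) Is)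

-- Analytic families of subsets of ω: projections of closed subsets of
-- 2^ω × ω^ω, the closed set given as the branches of T.

prefix : (ℕ → Bool) → (ℕ → ℕ) → ℕ → List (Bool × ℕ)
prefix x y n = map (λ i → x i , y i) (upTo n)

Analytic : Family ℕ → Set₁
Analytic I =
  Σ (List (Bool × ℕ) → Bool) λ T →
    ∀ A → I A ⇔ (Σ (ℕ → Bool) λ x → Σ (ℕ → ℕ) λ y →
                   (∀ n → A n ⇔ (x n ≡ true)) × (∀ n → T (prefix x y n) ≡ true))

Shelah1 : Family ℕ → Set₁
Shelah1 U =
  ∀ D → IsWO D → Nonempty D → (X : Set) (Jα : Family X) → FinRel D X Jα →
     Σ (Family ℕ) λ I → IsIdeal I × Isomorphic I Jα × (I ⊆F dual U)

Shelah2 : Family ℕ → Set₁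
Shelah2 U =
  ∀ I → IsIdeal I → Analytic I → (∀ A → I A → ¬ U A) →
     Σ WOData λ D → IsWO D × (Σ Set λ X → Σ (Family X) λ Jα → FinRel D X Jα ×
       (Σ (Family ℕ) λ J → IsIdeal J × KatetovEquiv J Jα ×
         (I ⊆F J) × (J ⊆F dual U)))

-- Shelah ultrafilter: an ultrafilter with
-- (1) for every 1 ≤ α < ω₁ an isomorphic copy of fin^α inside U*;
-- (2) every analytic ideal disjoint from U is contained in an ideal J ⊆ U*
--     Katětov equivalent to some fin^α (α < ω₁).
IsShelah : Family ℕ → Set₁
IsShelah U = IsUltrafilter U × Shelah1 U × Shelah2 U

-- By condition (1) with α = 2, the dual ideal U* contains a copy of
-- fin × fin, transported along a bijection g : ω → ω × ω. The preimages
-- of the sets "column ≥ n" are in U, since their complements meet only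
-- finitely many columns. A pseudo-intersection V ∈ U of them meets every
-- column in a finite set, so g[V] ∈ fin × fin and V ∈ U*: a contradiction.
module Submission where

open import Defs
open import Level using (0ℓ) renaming (suc to lsuc)
open import Axiom.ExcludedMiddle using (ExcludedMiddle)
open import Data.Nat using (ℕ; zero; suc; _<_; _≤_; _<ᵇ_; _⊔_; _≤?_; s≤s⁻¹)
open import Data.Nat.Properties
  using (<ᵇ⇒<; <-irrefl; ≤-trans; m≤m⊔n; m≤n⊔m; m≤n⇒m<n∨m≡n; ≰⇒>)
open import Data.Nat.Induction using (<-wellFounded)
open import Data.Bool using (true)
open import Data.Bool.Properties using (T-≡)
open import Data.Empty using (⊥; ⊥-elim)
open import Data.Product using (Σ; _×_; _,_; proj₁; proj₂)
open import Data.Sum using (_⊎_; inj₁; inj₂)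
open import Relation.Nullary using (¬_; Dec; yes; no)
open import Relation.Nullary.Decidable using (decidable-stable)
open import Relation.Binary.PropositionalEquality using (_≡_; refl; sym; cong)
open import Function using (_∘_)
open import Function.Bundles using (Bijection; Equivalence)
open import Induction.WellFounded using (module Subrelation)

two : WOData
two = record { dom = λ n → n <ᵇ 2 ; lt = _<ᵇ_ }

two-isWO : IsWO two
two-isWO = record
  { irrefl = irrefl
  ; trans  = trans
  ; total  = total
  ; wf     = Subrelation.wellFounded
               (λ {a} {b} (_ , _ , a≺b) → <ᵇ⇒< a b (Equivalence.from T-≡ a≺b))
               <-wellFounded
  }
  where
  irrefl : ∀ a → dom two a ≡ true → ¬ (a ≺[ two ] a)
  irrefl 0 _ ()
  irrefl 1 _ ()

  trans : ∀ a b c → dom two a ≡ true → dom two b ≡ true → dom two c ≡ true →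
          a ≺[ two ] b → b ≺[ two ] c → a ≺[ two ] c
  trans 0 1 1 _ _ _ _ ()

  total : ∀ a b → dom two a ≡ true → dom two b ≡ true →
          (a ≡ b) ⊎ (a ≺[ two ] b) ⊎ (b ≺[ two ] a)
  total 0 0 _ _ = inj₁ refl
  total 0 1 _ _ = inj₂ (inj₁ refl)
  total 1 0 _ _ = inj₂ (inj₂ refl)
  total 1 1 _ _ = inj₁ refl

finRel-two : FinRel two (ℕ × ℕ) (fin ×I fin)
finRel-two = frS 1 max-one (0 , refl) (fr1 0 refl below-one)
  where
  max-one : IsMax two 1
  max-one = refl , λ where
    0 _ _   → refl
    1 _ 1≢1 → ⊥-elim (1≢1 refl)

  below-one : ∀ n → dom (below two 1) n ≡ true → n ≡ 0
  below-one 0 _ = refl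
  below-one 1 ()
  below-one (suc (suc n)) ()

Finite-mono : ∀ {A B} → A ⊆ B → Finite B → Finite A
Finite-mono A⊆B (N , B<N) = N , λ k Ak → B<N k (A⊆B k Ak)

supBelow : (ℕ → ℕ) → ℕ → ℕ
supBelow h zero    = 0
supBelow h (suc N) = supBelow h N ⊔ suc (h N)

<-supBelow : ∀ h {N k} → k < N → h k < supBelow h N
<-supBelow h {suc N} k<1+N with m≤n⇒m<n∨m≡n (s≤s⁻¹ k<1+N)
... | inj₁ k<N  = ≤-trans (<-supBelow h k<N) (m≤m⊔n (supBelow h N) _)
... | inj₂ refl = m≤n⊔m (supBelow h N) _

Finite-image : (h : ℕ → ℕ) {A : Subset ℕ} → Finite A → Finite (image h A)
Finite-image h (N , A<N) =
  supBelow h N , λ where _ (k , Ak , refl) → <-supBelow h (A<N k Ak)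

column : ℕ × ℕ → ℕ
column = proj₁

fin×fin-fewColumns : ∀ n {A} → (∀ p → A p → column p < n) → (fin ×I fin) A
fin×fin-fewColumns n {A} A<n = n , λ i → infinite-column⇒<n i
  where
  infinite-column⇒<n : ∀ i → ¬ fin (λ y → A (i , y)) → i < n
  infinite-column⇒<n i infinite with n ≤? i
  ... | no n≰i  = ≰⇒> n≰i
  ... | yes n≤i = ⊥-elim (infinite (0 , λ y Aiy →
                    ⊥-elim (<-irrefl refl (≤-trans (A<n (i , y) Aiy) n≤i))))

fin×fin-finiteColumns : ∀ {A} → (∀ i → Finite (λ y → A (i , y))) → (fin ×I fin) A
fin×fin-finiteColumns finite = 0 , λ i infinite → ⊥-elim (infinite (finite i))

PProperty : Family ℕ → Set₁
PProperty U =
  (Us : ℕ → Subset ℕ) → (∀ n → U (Us n)) →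
  Σ (Subset ℕ) λ V → U V × (∀ n → Finite (λ k → V k × ¬ Us n k))

module _ {U : Family ℕ} (ultra : IsUltrafilter U) where
  open IsUltrafilter ultra

  ¬U-and-∁ : ∀ A → U A → U (∁ A) → ⊥
  ¬U-and-∁ A UA U∁A = no-∅ (up _ _ (λ _ (a , ¬a) → ¬a a) (inter A (∁ A) UA U∁A))

  dual-∁ : ∀ {A} → (∀ k → Dec (A k)) → dual U (∁ A) → U A
  dual-∁ A? = up _ _ (λ k → decidable-stable (A? k))

  -- Only the direction "g[A] ∈ fin × fin ⇒ A ∈ U*" of the copy is used.
  ¬PProperty-dual⊇fin×fin : (g : ℕ → ℕ × ℕ) →
    (∀ A → (fin ×I fin) (image g A) → dual U A) → ¬ PProperty U
  ¬PProperty-dual⊇fin×fin g copy pprop = ¬U-and-∁ V UV (copy V g[V]∈fin²)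
    where
    fromColumn : ℕ → Subset ℕ
    fromColumn n k = n ≤ column (g k)

    U-fromColumn : ∀ n → U (fromColumn n)
    U-fromColumn n = dual-∁ (λ k → n ≤? column (g k))
      (copy _ (fin×fin-fewColumns n λ where _ (k , k<n , refl) → ≰⇒> k<n))

    pseudoIntersection : Σ (Subset ℕ) λ V → U V × (∀ n → Finite (λ k → V k × ¬ fromColumn n k))
    pseudoIntersection = pprop fromColumn U-fromColumn

    V : Subset ℕ
    V = proj₁ pseudoIntersection

    UV : U V
    UV = proj₁ (proj₂ pseudoIntersection)

    g[V]∈fin² : (fin ×I fin) (image g V)
    g[V]∈fin² = fin×fin-finiteColumns λ i →
      Finite-mono
        (λ where y (k , Vk , gk≡iy) →
                   k , (Vk , <-irrefl (sym (cong column gk≡iy))) , cong proj₂ gk≡iy)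
        (Finite-image (proj₂ ∘ g) (proj₂ (proj₂ pseudoIntersection) (suc i)))

-- The argument is constructive: only condition (1), for α = 2, is used.
mainTheorem18 : ExcludedMiddle 0ℓ → ExcludedMiddle (lsuc 0ℓ) →
    (U : Family ℕ) → IsShelah U → ¬ IsPPoint U
mainTheorem18 _ _ U (ultra , shelah₁ , _) (_ , _ , pprop)
  with shelah₁ two two-isWO (0 , refl) (ℕ × ℕ) (fin ×I fin) finRel-two
... | _ , _ , (g , iso) , I⊆U* =
  ¬PProperty-dual⊇fin×fin ultra (Bijection.to g)
    (λ A g[A]∈fin² → I⊆U* A (Equivalence.to (iso A) g[A]∈fin²)) pprop
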